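{- Let $G\in\mathfrak{D}$, $H\in\mathfrak{D}_r$, $\zeta\in\mathcal{H}(G,H)$, and let $\mathcal{L}$ be a set of subgraphs of $G$. For every $L\in\mathcal{L}$ let $\alpha_L$ be a $\zeta|_L$-selecting arc weight of $L$ within $\mathcal{H}(L,H)$. Define $\beta:A(G^*)\to\mathbb{N}_0$ by $\beta(v,w)=\sum_{L\in\mathcal{L},\ vw\in A(L^*)}\alpha_L(v,w)$. Then $\beta$ is a $\zeta$-selecting arc weight of $G$ within $\mathcal{H}(G,H)$.
   Context: A digraph $G=(V(G),A(G))$ has finite nonempty vertex set and arc set $A(G)\subseteq V(G)\times V(G)$; $vw$ denotes $(v,w)$; $G^*$ is $G$ with loops removed. $\mathfrak{D}$: all digraphs; $\mathfrak{D}_r$: reflexive digraphs; $\mathcal{H}(G,H)$: homomorphisms. A subgraph $L\subseteq G$ has $V(L)\subseteq V(G)$, $A(L)\subseteq A(G)$; $\zeta|_L$ is the restriction to $V(L)$. An arc weight of $G$ is a map $\alpha:A(G^*)\to\mathbb{N}_0$; $D(\alpha)=\{vw:\alpha(v,w)>0\}$. $[v,w]_H=\{u:vu,uw\in A(H)\}$, $\iota(v,w)_H=\#[v,w]_H$; for $\xi\in\mathcal{H}(G,H)$, $\iota_\xi(v,w)=\iota(\xi(v),\xi(w))_H$, $\iota_{\xi,B}$ its restriction to $B$, and $\pi_\alpha(\xi)=\prod_{vw\in A(G^*)}\iota_\xi(v,w)^{\alpha(v,w)}$. For $\zeta\in\mathcal{H}(G,H)$, an arc weight $\alpha$ of $G$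 is $\zeta$-selecting within $\mathcal{H}(G,H)$ if for all $\xi\in\mathcal{H}(G,H)$, $\pi_\alpha(\xi)\le\pi_\alpha(\zeta)$ with equality iff $\iota_{\xi,D(\alpha)}=\iota_{\zeta,D(\alpha)}$. -}

module Defs where

open import Data.Nat using (ℕ; zero; suc; _+_; _*_; _^_; _≤_; _<_)
open import Data.Bool using (Bool; true; false; T; _∧_; if_then_else_)
open import Data.Bool.Properties using (T?)
open import Data.Fin using (Fin; _≟_)
open import Data.List using (List; []; _∷_; _++_; map; concatMap; allFin)
open import Data.Nat.ListAction using (sum; product)
open import Data.Product using (Σ; ∃; ∃-syntax; _×_; _,_; proj₁; proj₂)
open import Relation.Nullary using (¬_; yes; no; Dec)
open import Relation.Nullary.Decidable using (⌊_⌋)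
open import Relation.Binary.PropositionalEquality using (_≡_)
open import Function using (_∘_; _⇔_)
open import Function.Definitions using (Injective)

-- A digraph: finite nonempty vertex set Fin n (n > 0) and a decidable arc
-- relation (loops allowed).
record Digraph : Set where
  field
    n        : ℕ
    nonempty : 0 < n
    arc      : Fin n → Fin n → Bool

open Digraph public

Vertex : Digraph → Set
Vertex G = Fin (n G)

Arc : (G : Digraph) → Vertex G → Vertex G → Set
Arc G v w = T (arc G v w)

Reflexive : Digraph → Set
Reflexive H = ∀ v → Arc H v v

ArcStar : Digraph → Set
ArcStar G = Σ (Vertex G) λ v → Σ (Vertex G) λ w → Arc G v w × ¬ (v ≡ w)

-- Explicit enumeration of A(G*), each element exactly once.
arcsFrom : (G : Digraph) → Vertex G → Vertex G → List (ArcStar G)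
arcsFrom G v w with T? (arc G v w) | v ≟ w
... | yes a | no v≢w = (v , w , a , v≢w) ∷ []
... | _     | _      = []

arcList : (G : Digraph) → List (ArcStar G)
arcList G = concatMap (λ v → concatMap (arcsFrom G v) (allFin (n G))) (allFin (n G))

Hom : Digraph → Digraph → Set
Hom G H = Σ (Vertex G → Vertex H) λ f → ∀ v w → Arc G v w → Arc H (f v) (f w)

ArcWeight : Digraph → Set
ArcWeight G = ArcStar G → ℕ

ι : (H : Digraph) → Vertex H → Vertex H → ℕ
ι H v w = sum (map (λ u → if arc H v u ∧ arc H u w then 1 else 0) (allFin (n H)))

ιhom : (G H : Digraph) → Hom G H → ArcStar G → ℕ
ιhom G H ξ (v , w , _) = ι H (proj₁ ξ v) (proj₁ ξ w)

π : (G H : Digraph) → ArcWeight G → Hom G H → ℕ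
π G H α ξ = product (map (λ a → ιhom G H ξ a ^ α a) (arcList G))

Selecting : (G H : Digraph) → Hom G H → ArcWeight G → Set
Selecting G H ζ α =
  ∀ (ξ : Hom G H) →
    (π G H α ξ ≤ π G H α ζ) ×
    ((π G H α ξ ≡ π G H α ζ) ⇔
       (∀ (a : ArcStar G) → 0 < α a → ιhom G H ξ a ≡ ιhom G H ζ a))

-- A subgraph L of G: a digraph together with an injective vertex map into G
-- that maps arcs to arcs (V(L) ⊆ V(G), A(L) ⊆ A(G), up to renaming V(L)).
record Subgraph (G : Digraph) : Set where
  field
    graph   : Digraph
    emb     : Vertex graph → Vertex G
    emb-inj : Injective _≡_ _≡_ emb
    emb-arc : ∀ x y → Arc graph x y → Arc G (emb x) (emb y)

open Subgraph public

InV : {G : Digraph} → Subgraph G → Vertex G → Set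
InV L v = ∃[ x ] emb L x ≡ v

InA : {G : Digraph} → Subgraph G → Vertex G → Vertex G → Set
InA L v w = ∃[ x ] ∃[ y ] (emb L x ≡ v × emb L y ≡ w × Arc (graph L) x y)

SameSubgraph : {G : Digraph} → Subgraph G → Subgraph G → Set
SameSubgraph L M = (∀ v → InV L v ⇔ InV M v) × (∀ v w → InA L v w ⇔ InA M v w)

restrict : (G H : Digraph) → Hom G H → (L : Subgraph G) → Hom (graph L) H
restrict G H ζ L = (proj₁ ζ ∘ emb L) , λ x y a → proj₂ ζ (emb L x) (emb L y) (emb-arc L x y a)

-- Contribution of α_L to β(v,w): α_L at the (unique, if any) arc xy of L*
-- with emb x = v and emb y = w.
contrib : {G : Digraph} (L : Subgraph G) → ArcWeight (graph L) → Vertex G → Vertex G → ℕ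
contrib L αL v w =
  sum (map (λ b → if ⌊ emb L (proj₁ b) ≟ v ⌋ ∧ ⌊ emb L (proj₁ (proj₂ b)) ≟ w ⌋
                  then αL b else 0)
           (arcList (graph L)))

β : {G : Digraph} {k : ℕ} (𝓛 : Fin k → Subgraph G) →
    ((i : Fin k) → ArcWeight (graph (𝓛 i))) → ArcWeight G
β {k = k} 𝓛 α (v , w , _) = sum (map (λ i → contrib (𝓛 i) (α i) v w) (allFin k))

module Submission where

-- Write ι_ξ(a) for ι(ξ(v),ξ(w))_H at an arc a = vw of G*.
-- Since β is a sum of the weights α_L, the product π_β(ξ) factorises:
--     π_β(ξ) = ∏_a ι_ξ(a)^(Σ_L α_L(a)) = ∏_L ∏_{b ∈ A(L*)} ι_ξ(b)^(α_L(b)) = ∏_L π_{α_L}(ξ|_L),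
-- where exchanging the products uses that arcList enumerates A(G*) without
-- repetition and that a subgraph embedding maps arcs of L* to arcs of G*.
-- Each factor satisfies π_{α_L}(ξ|_L) ≤ π_{α_L}(ζ|_L) since α_L is
-- ζ|_L-selecting, and is positive since H is reflexive.  Hence π_β(ξ) ≤ π_β(ζ),
-- and equality forces equality of every factor, so ι_ξ and ι_ζ agree on each
-- D(α_L), and D(β) is their union.  Conversely π_α(ξ) only sees ι_ξ on D(α).

open import Defs
open import Data.Nat using (ℕ; zero; suc; _*_; _^_; _≤_; _<_; z≤n; s≤s; >-nonZero)
open import Data.Nat.Properties
  using (≤-refl; <-irrefl; <-≤-trans; m≤n⇒m<n∨m≡n; *-mono-≤; *-mono-<; *-monoˡ-<; *-monoʳ-≤;
         *-cancelˡ-≡; *-identityʳ; m≤m+n; m≤n+m; +-identityʳ; [m*n]*[o*p]≡[m*o]*[n*p]; ^-distribˡ-+-*; m^n>0)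
open import Data.Nat.ListAction using (sum; product)
open import Data.Nat.ListAction.Properties using (product-++)
open import Data.Bool using (true; T; _∧_; if_then_else_)
open import Data.Bool.Properties using (T?)
open import Data.Fin using (Fin; _≟_) renaming (zero to fzero; suc to fsuc)
open import Data.Fin.Properties using (suc-injective)
open import Data.List using (List; []; _∷_; _++_; map; concatMap; allFin; tabulate)
open import Data.List.Properties using (map-cong; map-++; map-tabulate)
open import Data.List.Membership.Propositional using (_∈_)
open import Data.List.Membership.Propositional.Properties using (∈-allFin)
open import Data.List.Relation.Unary.Any using (here; there)
open import Data.Product using (Σ; ∃-syntax; _×_; _,_; proj₁; proj₂)
open import Data.Sum using (_⊎_; inj₁; inj₂)
open import Data.Empty using (⊥-elim)
open import Relation.Nullary using (Dec; yes; no)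
open import Relation.Nullary.Decidable using (⌊_⌋)
open import Relation.Binary.PropositionalEquality
open import Function using (_∘_; mk⇔)
open import Function.Bundles using (Equivalence)

*-≡-split : ∀ {a b c d} → 0 < a → 0 < c → a ≤ b → c ≤ d → a * c ≡ b * d → a ≡ b × c ≡ d
*-≡-split {a} {b} {c} {d} a>0 c>0 a≤b c≤d eq with m≤n⇒m<n∨m≡n a≤b
... | inj₁ a<b = ⊥-elim (<-irrefl eq (<-≤-trans (*-monoˡ-< c {{>-nonZero c>0}} a<b) (*-monoʳ-≤ b c≤d)))
... | inj₂ refl = refl , *-cancelˡ-≡ c d a {{>-nonZero a>0}} eq

module _ {A : Set} where

  ^-sum : ∀ x (f : A → ℕ) xs → x ^ sum (map f xs) ≡ product (map (λ y → x ^ f y) xs)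
  ^-sum x f []       = refl
  ^-sum x f (y ∷ ys) = trans (^-distribˡ-+-* x (f y) (sum (map f ys))) (cong (x ^ f y *_) (^-sum x f ys))

  product-ones : (f : A → ℕ) → (∀ y → f y ≡ 1) → ∀ xs → product (map f xs) ≡ 1
  product-ones f f≡1 []       = refl
  product-ones f f≡1 (y ∷ ys) rewrite f≡1 y | product-ones f f≡1 ys = refl

  product-* : (f g : A → ℕ) → ∀ xs → product (map f xs) * product (map g xs) ≡ product (map (λ y → f y * g y) xs)
  product-* f g []       = refl
  product-* f g (y ∷ ys) =
    trans ([m*n]*[o*p]≡[m*o]*[n*p] (f y) (product (map f ys)) (g y) (product (map g ys)))
          (cong (f y * g y *_) (product-* f g ys))

  product-mono : {f g : A → ℕ} → (∀ y → f y ≤ g y) → ∀ xs → product (map f xs) ≤ product (map g xs)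
  product-mono f≤g []       = ≤-refl
  product-mono f≤g (y ∷ ys) = *-mono-≤ (f≤g y) (product-mono f≤g ys)

  product-pos : {f : A → ℕ} → (∀ y → 0 < f y) → ∀ xs → 0 < product (map f xs)
  product-pos f>0 []       = s≤s z≤n
  product-pos f>0 (y ∷ ys) = *-mono-< (f>0 y) (product-pos f>0 ys)

  product-≡⇒pointwise : {f g : A → ℕ} → (∀ y → 0 < f y) → (∀ y → f y ≤ g y) → ∀ xs →
                        product (map f xs) ≡ product (map g xs) → ∀ {x} → x ∈ xs → f x ≡ g x
  product-≡⇒pointwise f>0 f≤g (y ∷ ys) eq x∈ with *-≡-split (f>0 y) (product-pos f>0 ys) (f≤g y) (product-mono f≤g ys) eq
  product-≡⇒pointwise f>0 f≤g (y ∷ ys) eq (here refl) | fy≡gy , _    = fy≡gy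
  product-≡⇒pointwise f>0 f≤g (y ∷ ys) eq (there x∈) | _     , rest = product-≡⇒pointwise f>0 f≤g ys rest x∈

  sum-pos⇒ : (f : A → ℕ) → ∀ xs → 0 < sum (map f xs) → ∃[ x ] 0 < f x
  sum-pos⇒ f (y ∷ ys) pos with f y in eq
  ... | suc _ = y , subst (0 <_) (sym eq) (s≤s z≤n)
  ... | zero  = sum-pos⇒ f ys pos

  sum-pos⇐ : (f : A → ℕ) → ∀ {xs x} → x ∈ xs → 0 < f x → 0 < sum (map f xs)
  sum-pos⇐ f {y ∷ ys} (here refl) pos = <-≤-trans pos (m≤m+n (f y) _)
  sum-pos⇐ f {y ∷ ys} (there x∈)  pos = <-≤-trans (sum-pos⇐ f x∈ pos) (m≤n+m _ (f y))

  product-concatMap : (g : A → ℕ) {B : Set} (F : B → List A) (bs : List B) →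
    product (map g (concatMap F bs)) ≡ product (map (λ b → product (map g (F b))) bs)
  product-concatMap g F []       = refl
  product-concatMap g F (b ∷ bs) = begin
    product (map g (F b ++ concatMap F bs))                  ≡⟨ cong product (map-++ g (F b) (concatMap F bs)) ⟩
    product (map g (F b) ++ map g (concatMap F bs))          ≡⟨ product-++ (map g (F b)) _ ⟩
    product (map g (F b)) * product (map g (concatMap F bs)) ≡⟨ cong (product (map g (F b)) *_) (product-concatMap g F bs) ⟩
    product (map g (F b)) * product (map (λ b → product (map g (F b))) bs) ∎
    where open ≡-Reasoning

product-swap : {A B : Set} (f : A → B → ℕ) (xs : List A) (ys : List B) →
  product (map (λ x → product (map (f x) ys)) xs) ≡ product (map (λ y → product (map (λ x → f x y) xs)) ys)
product-swap f []       ys = sym (product-ones (λ _ → 1) (λ _ → refl) ys)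
product-swap f (x ∷ xs) ys = trans (cong (product (map (f x) ys) *_) (product-swap f xs ys))
                                   (product-* (f x) (λ y → product (map (λ x → f x y) xs)) ys)

product-tabulate-ones : ∀ {m} (f : Fin m → ℕ) → (∀ u → f u ≡ 1) → product (tabulate f) ≡ 1
product-tabulate-ones {zero}  f f≡1 = refl
product-tabulate-ones {suc m} f f≡1 rewrite f≡1 fzero | product-tabulate-ones (f ∘ fsuc) (f≡1 ∘ fsuc) = refl

product-tabulate-single : ∀ {m} (f : Fin m → ℕ) v → (∀ u → u ≢ v → f u ≡ 1) → product (tabulate f) ≡ f v
product-tabulate-single {suc m} f fzero    off
  rewrite product-tabulate-ones (f ∘ fsuc) (λ u → off (fsuc u) (λ ())) = *-identityʳ (f fzero)
product-tabulate-single {suc m} f (fsuc v) off rewrite off fzero (λ ()) =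
  trans (+-identityʳ _) (product-tabulate-single (f ∘ fsuc) v (λ u u≢v → off (fsuc u) (u≢v ∘ suc-injective)))

product-allFin-single : ∀ {m} (f : Fin m → ℕ) v → (∀ u → u ≢ v → f u ≡ 1) → product (map f (allFin m)) ≡ f v
product-allFin-single f v off = trans (cong product (map-tabulate (λ x → x) f)) (product-tabulate-single f v off)

pointWeight : (G : Digraph) → Vertex G → Vertex G → ℕ → ArcStar G → ℕ
pointWeight G v w c (v' , w' , _) = if ⌊ v ≟ v' ⌋ ∧ ⌊ w ≟ w' ⌋ then c else 1

-- arcList G enumerates A(G*) without repetition: the product of pointWeight
-- over it picks out the single factor c.
module _ (G : Digraph) (v w : Vertex G) (c : ℕ) where

  private
    atPair : Vertex G → Vertex G → ℕ
    atPair v' w' = product (map (pointWeight G v w c) (arcsFrom G v' w'))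

    atPair-off : ∀ v' w' → v' ≢ v ⊎ w' ≢ w → atPair v' w' ≡ 1
    atPair-off v' w' off with T? (arc G v' w') | v' ≟ w'
    ... | yes _ | yes _ = refl
    ... | no _  | _     = refl
    ... | yes _ | no _ with v ≟ v' | w ≟ w' | off
    ...   | yes refl | yes refl | inj₁ v≢v = ⊥-elim (v≢v refl)
    ...   | yes refl | yes refl | inj₂ w≢w = ⊥-elim (w≢w refl)
    ...   | yes _    | no _     | _        = refl
    ...   | no _     | _        | _        = refl

    atPair-on : Arc G v w → v ≢ w → atPair v w ≡ c
    atPair-on vw v≢w with T? (arc G v w) | v ≟ w
    ... | no ¬vw | _       = ⊥-elim (¬vw vw)
    ... | yes _  | yes v≡w = ⊥-elim (v≢w v≡w)
    ... | yes _  | no _ with v ≟ v | w ≟ w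
    ...   | yes _ | yes _ = *-identityʳ c
    ...   | no v≢v | _      = ⊥-elim (v≢v refl)
    ...   | yes _  | no w≢w = ⊥-elim (w≢w refl)

    row : Vertex G → ℕ
    row v' = product (map (atPair v') (allFin (n G)))

    row-off : ∀ v' → v' ≢ v → row v' ≡ 1
    row-off v' v'≢v = product-ones (atPair v') (λ w' → atPair-off v' w' (inj₁ v'≢v)) (allFin (n G))

  product-pointWeight : Arc G v w → v ≢ w → product (map (pointWeight G v w c) (arcList G)) ≡ c
  product-pointWeight vw v≢w = begin
    product (map g (arcList G))
      ≡⟨ product-concatMap g _ (allFin (n G)) ⟩
    product (map (λ v' → product (map g (concatMap (arcsFrom G v') (allFin (n G))))) (allFin (n G)))
      ≡⟨ cong product (map-cong (λ v' → product-concatMap g (arcsFrom G v') (allFin (n G))) (allFin (n G))) ⟩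
    product (map row (allFin (n G)))
      ≡⟨ product-allFin-single row v row-off ⟩
    row v
      ≡⟨ product-allFin-single (atPair v) w (λ w' w'≢w → atPair-off v w' (inj₂ w'≢w)) ⟩
    atPair v w
      ≡⟨ atPair-on vw v≢w ⟩
    c ∎
    where
      open ≡-Reasoning
      g : ArcStar G → ℕ
      g = pointWeight G v w c

-- In a reflexive digraph, [p,q] contains p whenever pq is an arc, so ι(p,q) > 0.
ι-pos : (H : Digraph) → Reflexive H → ∀ p q → Arc H p q → 0 < ι H p q
ι-pos H reflH p q pq = sum-pos⇐ (λ u → if arc H p u ∧ arc H u q then 1 else 0) (∈-allFin p) (both (reflH p) pq)
  where
    both : ∀ {b₁ b₂} → T b₁ → T b₂ → 0 < (if b₁ ∧ b₂ then 1 else 0)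
    both {true} {true} _ _ = s≤s z≤n

π-pos : (G H : Digraph) → Reflexive H → (α : ArcWeight G) (ξ : Hom G H) → 0 < π G H α ξ
π-pos G H reflH α ξ = product-pos factor-pos (arcList G)
  where
    factor-pos : ∀ a → 0 < ιhom G H ξ a ^ α a
    factor-pos a@(v , w , vw , _) =
      m^n>0 (ιhom G H ξ a) {{>-nonZero (ι-pos H reflH _ _ (proj₂ ξ v w vw))}} (α a)

π-agree : (G H : Digraph) (α : ArcWeight G) (ξ ζ : Hom G H) →
          (∀ a → 0 < α a → ιhom G H ξ a ≡ ιhom G H ζ a) → π G H α ξ ≡ π G H α ζ
π-agree G H α ξ ζ agree = cong product (map-cong factor-≡ (arcList G))
  where
    factor-≡ : ∀ a → ιhom G H ξ a ^ α a ≡ ιhom G H ζ a ^ α a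
    factor-≡ a with α a in αa
    ... | zero  = refl
    ... | suc _ rewrite agree a (subst (0 <_) (sym αa) (s≤s z≤n)) = refl

module _ (G H : Digraph) (ξ : Hom G H) where

  -- Each arc b = xy of L* lands
  -- on the single arc (emb x)(emb y) of G*, where ι_ξ equals ι_{ξ|_L}(b).
  π-contrib : (L : Subgraph G) (αL : ArcWeight (graph L)) →
    product (map (λ a → ιhom G H ξ a ^ contrib L αL (proj₁ a) (proj₁ (proj₂ a))) (arcList G)) ≡
    π (graph L) H αL (restrict G H ξ L)
  π-contrib L αL = begin
    product (map (λ a → ιhom G H ξ a ^ contrib L αL (proj₁ a) (proj₁ (proj₂ a))) (arcList G))
      ≡⟨ cong product (map-cong (λ a → ^-sum (ιhom G H ξ a) _ (arcList (graph L))) (arcList G)) ⟩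
    product (map (λ a → product (map (λ b → ιhom G H ξ a ^ exponent a b) (arcList (graph L)))) (arcList G))
      ≡⟨ cong product (map-cong (λ a → cong product (map-cong (landing a) (arcList (graph L)))) (arcList G)) ⟩
    product (map (λ a → product (map (λ b → image b a) (arcList (graph L)))) (arcList G))
      ≡⟨ product-swap (λ a b → image b a) (arcList G) (arcList (graph L)) ⟩
    product (map (λ b → product (map (image b) (arcList G))) (arcList (graph L)))
      ≡⟨ cong product (map-cong image-product (arcList (graph L))) ⟩
    π (graph L) H αL (restrict G H ξ L) ∎
    where
      open ≡-Reasoning
      exponent : ArcStar G → ArcStar (graph L) → ℕ
      exponent (v , w , _) b =
        if ⌊ emb L (proj₁ b) ≟ v ⌋ ∧ ⌊ emb L (proj₁ (proj₂ b)) ≟ w ⌋ then αL b else 0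

      factorL : ArcStar (graph L) → ℕ
      factorL b = ιhom (graph L) H (restrict G H ξ L) b ^ αL b

      image : ArcStar (graph L) → ArcStar G → ℕ
      image b = pointWeight G (emb L (proj₁ b)) (emb L (proj₁ (proj₂ b))) (factorL b)

      landing : ∀ a b → ιhom G H ξ a ^ exponent a b ≡ image b a
      landing (v , w , _) (x , y , _) with emb L x ≟ v | emb L y ≟ w
      ... | yes refl | yes refl = refl
      ... | yes _    | no _     = refl
      ... | no _     | _        = refl

      image-product : ∀ b → product (map (image b) (arcList G)) ≡ factorL b
      image-product b@(x , y , xy , x≢y) =
        product-pointWeight G (emb L x) (emb L y) (factorL b) (emb-arc L x y xy) (x≢y ∘ emb-inj L)

  π-β : {k : ℕ} (𝓛 : Fin k → Subgraph G) (α : (i : Fin k) → ArcWeight (graph (𝓛 i))) →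
        π G H (β 𝓛 α) ξ ≡ product (map (λ i → π (graph (𝓛 i)) H (α i) (restrict G H ξ (𝓛 i))) (allFin k))
  π-β {k} 𝓛 α = begin
    π G H (β 𝓛 α) ξ
      ≡⟨ cong product (map-cong (λ a → ^-sum (ιhom G H ξ a) _ (allFin k)) (arcList G)) ⟩
    product (map (λ a → product (map (λ i → part i a) (allFin k))) (arcList G))
      ≡⟨ product-swap (λ a i → part i a) (arcList G) (allFin k) ⟩
    product (map (λ i → product (map (part i) (arcList G))) (allFin k))
      ≡⟨ cong product (map-cong (λ i → π-contrib (𝓛 i) (α i)) (allFin k)) ⟩
    product (map (λ i → π (graph (𝓛 i)) H (α i) (restrict G H ξ (𝓛 i))) (allFin k)) ∎
    where
      open ≡-Reasoning
      part : Fin k → ArcStar G → ℕ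
      part i a = ιhom G H ξ a ^ contrib (𝓛 i) (α i) (proj₁ a) (proj₁ (proj₂ a))

if-both-pos : ∀ {P Q : Set} (p : Dec P) (q : Dec Q) {m} → 0 < (if ⌊ p ⌋ ∧ ⌊ q ⌋ then m else 0) → P × Q × 0 < m
if-both-pos (yes p) (yes q) pos = p , q , pos

β-support : {G : Digraph} {k : ℕ} (𝓛 : Fin k → Subgraph G) (α : (i : Fin k) → ArcWeight (graph (𝓛 i))) →
  (a : ArcStar G) → 0 < β 𝓛 α a →
  Σ (Fin k) λ i → Σ (ArcStar (graph (𝓛 i))) λ b →
    0 < α i b × emb (𝓛 i) (proj₁ b) ≡ proj₁ a × emb (𝓛 i) (proj₁ (proj₂ b)) ≡ proj₁ (proj₂ a)
β-support {k = k} 𝓛 α (v , w , _) pos with sum-pos⇒ (λ i → contrib (𝓛 i) (α i) v w) (allFin k) pos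
... | i , contrib>0 with sum-pos⇒ _ (arcList (graph (𝓛 i))) contrib>0
...   | b , term>0 with if-both-pos (emb (𝓛 i) (proj₁ b) ≟ v) (emb (𝓛 i) (proj₁ (proj₂ b)) ≟ w) term>0
...     | x↦v , y↦w , αb>0 = i , b , αb>0 , x↦v , y↦w

lemma3 : (G H : Digraph) → Reflexive H → (ζ : Hom G H) →
         (k : ℕ) (𝓛 : Fin k → Subgraph G) →
         (∀ i j → SameSubgraph (𝓛 i) (𝓛 j) → i ≡ j) →
         (α : (i : Fin k) → ArcWeight (graph (𝓛 i))) →
         (∀ i → Selecting (graph (𝓛 i)) H (restrict G H ζ (𝓛 i)) (α i)) →
         Selecting G H ζ (β 𝓛 α)
lemma3 G H reflH ζ k 𝓛 _ α selecting ξ = π≤ , mk⇔ equal⇒agree (π-agree G H (β 𝓛 α) ξ ζ)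
  where
    P : Hom G H → Fin k → ℕ
    P χ i = π (graph (𝓛 i)) H (α i) (restrict G H χ (𝓛 i))

    P≤ : ∀ i → P ξ i ≤ P ζ i
    P≤ i = proj₁ (selecting i (restrict G H ξ (𝓛 i)))

    P>0 : ∀ i → 0 < P ξ i
    P>0 i = π-pos (graph (𝓛 i)) H reflH (α i) (restrict G H ξ (𝓛 i))

    π≤ : π G H (β 𝓛 α) ξ ≤ π G H (β 𝓛 α) ζ
    π≤ = subst₂ _≤_ (sym (π-β G H ξ 𝓛 α)) (sym (π-β G H ζ 𝓛 α)) (product-mono P≤ (allFin k))

    equal⇒agree : π G H (β 𝓛 α) ξ ≡ π G H (β 𝓛 α) ζ →
                  ∀ a → 0 < β 𝓛 α a → ιhom G H ξ a ≡ ιhom G H ζ a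
    equal⇒agree eq (v , w , vw , v≢w) β>0 with β-support 𝓛 α (v , w , vw , v≢w) β>0
    ... | i , b , αb>0 , refl , refl =
      Equivalence.to (proj₂ (selecting i (restrict G H ξ (𝓛 i)))) Pi≡ b αb>0
      where
        Pi≡ : P ξ i ≡ P ζ i
        Pi≡ = product-≡⇒pointwise P>0 P≤ (allFin k)
                (trans (sym (π-β G H ξ 𝓛 α)) (trans eq (π-β G H ζ 𝓛 α))) (∈-allFin i)
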